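{- Let $G$ be an edge-colored graph of order $n\geq 3$. If $e(G)+c(G)\geq\binom{n+1}{2}$ and $G$ contains exactly one rainbow triangle, then $e(G)+c(G)=\binom{n+1}{2}$ and $G$ is complete.
   Context: Graphs are finite and simple. An edge-colored graph is a graph $G$ with a map $C:E(G)\to\mathbb{N}$. $e(G)$ is the number of edges and $c(G)$ the number of distinct colors on $E(G)$. A subgraph is rainbow if all its edges have distinct colors. -}

module Defs where

open import Data.Nat using (ℕ; _<_; _≟_)
open import Data.Nat.Properties using (<-strictTotalOrder)
open import Data.Bool using (Bool; true; false; _∧_; T)
open import Data.Fin using (Fin; toℕ)
import Data.Fin.Properties as FinP
open import Data.List using (List; []; _∷_; allFin; concatMap; filter; map; length; deduplicate)
open import Data.Product using (_×_; _,_)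
open import Relation.Nullary using (¬_; Dec; yes; no)
open import Relation.Nullary.Decidable using (⌊_⌋; _×-dec_; ¬?)
open import Relation.Binary.PropositionalEquality using (_≡_)

record Graph (n : ℕ) : Set where
  field
    adj   : Fin n → Fin n → Bool
    sym   : ∀ i j → adj i j ≡ adj j i
    irrefl : ∀ i → adj i i ≡ false
open Graph public

-- An edge coloring C : E(G) → ℕ, represented by a symmetric function on
-- vertex pairs (its values on non-edges are irrelevant).
record Coloring {n : ℕ} (G : Graph n) : Set where
  field
    col    : Fin n → Fin n → ℕ
    colSym : ∀ i j → col i j ≡ col j i
open Coloring public

edges : ∀ {n} → Graph n → List (Fin n × Fin n)
edges {n} G =
  filter (λ p → let (i , j) = p in FinP._<?_ i j ×-dec Data.Bool._≟_ (adj G i j) true)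
         (concatMap (λ i → map (i ,_) (allFin n)) (allFin n))
  where import Data.Bool

e : ∀ {n} → Graph n → ℕ
e G = length (edges G)

c : ∀ {n} {G : Graph n} → Coloring G → ℕ
c {G = G} C = length (deduplicate _≟_ (map (λ p → let (i , j) = p in col C i j) (edges G)))

Triangle : ∀ {n} → Graph n → Fin n → Fin n → Fin n → Set
Triangle G i j k =
  (toℕ i < toℕ j) × (toℕ j < toℕ k) ×
  (adj G i j ≡ true) × (adj G j k ≡ true) × (adj G i k ≡ true)

Rainbow : ∀ {n} {G : Graph n} → Coloring G → Fin n → Fin n → Fin n → Set
Rainbow C i j k =
  (¬ col C i j ≡ col C j k) × (¬ col C i j ≡ col C i k) × (¬ col C j k ≡ col C i k)

RainbowTriangle : ∀ {n} {G : Graph n} → Coloring G → Fin n → Fin n → Fin n → Set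
RainbowTriangle {G = G} C i j k = Triangle G i j k × Rainbow C i j k

-- G contains exactly one rainbow triangle (as a set of three vertices,
-- listed in increasing order)
ExactlyOneRainbowTriangle : ∀ {n} {G : Graph n} → Coloring G → Set
ExactlyOneRainbowTriangle {n} C =
  Data.Product.Σ (Fin n × Fin n × Fin n) λ t → let (i , j , k) = t in
    RainbowTriangle C i j k ×
    (∀ i' j' k' → RainbowTriangle C i' j' k' → (i' , j' , k') ≡ (i , j , k))
  where import Data.Product

Complete : ∀ {n} → Graph n → Set
Complete {n} G = ∀ (i j : Fin n) → ¬ i ≡ j → adj G i j ≡ true

module Submission where

-- Write W(S) = 2 (e(S) + c(S)) for the subgraph induced by a vertex set S. Deleting a vertex v
-- lowers W by 2 (deg v + own v), where own v counts the colours that occur in S only on edges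
-- at v, while (∣S∣ + 1) C 2 drops by ∣S∣. So if a bound e(S) + c(S) + s ≤ (∣S∣ + 1) C 2 holds
-- for every S − v but fails for S, then every vertex v has own v ≥ 2 + nondeg v (the number of
-- its non-neighbours), up to correction terms for the vertices of the rainbow triangle and of a
-- non-edge. Take u with own u maximal and a colour seen only at u, on an edge ux. The colours
-- seen only at u are: the colour of ux, one colour per non-neighbour of x, and at most one more,
-- which spans a rainbow triangle with u and x. Hence own x > own u, unless x is an endpoint of
-- the non-edge; repeating the argument from x yields an adjacent second endpoint, which is
-- absurd. Induction on ∣S∣ then gives e + c < (∣S∣ + 1) C 2 without rainbow triangles (by two
-- with a non-edge), and e + c ≤ (∣S∣ + 1) C 2 when all rainbow triangles lie in a fixed 3-set
-- (strictly with a non-edge). The whole graph, with its only rainbow triangle, is such an S.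

open import Data.Bool.Base using (Bool; true; false; _∧_; not; if_then_else_)
import Data.Bool.Properties as Bool
open import Data.Empty using (⊥; ⊥-elim)
open import Data.Fin.Base using (Fin; zero; suc; toℕ; fromℕ<)
open import Data.Fin.Properties using (_≟_; _<?_; <-cmp; <-asym; any?; toℕ-injective; toℕ-fromℕ<; suc-injective)
open import Data.List.Base
  using (List; []; _∷_; _++_; length; map; filter; tabulate; concatMap; allFin; deduplicate)
open import Data.List.Extrema.Nat using (argmax; f[xs]≤f[argmax])
open import Data.List.Membership.Propositional using (_∈_)
open import Data.List.Membership.Propositional.Properties
  using (∈-allFin; ∈-map⁺; ∈-map∘filter⁺; ∈-map∘filter⁻; ∈-concat⁺′; ∈-deduplicate⁻; ∈-deduplicate⁺)
open import Data.List.Properties using (length-removeAt′; filter-++; length-++; map-tabulate)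
open import Data.List.Relation.Unary.All as All using (All)
open import Data.List.Relation.Unary.Any using (here; there; _─_)
open import Data.List.Relation.Unary.Unique.Propositional using (Unique)
open import Data.Nat.Base using (ℕ; zero; suc; _+_; _*_; _≤_; _<_; _≥_; z≤n; s≤s)
open import Data.Nat.Combinatorics using (_C_; nC1≡n; nCk+nC[k+1]≡[n+1]C[k+1])
import Data.Nat.Properties as ℕ
open import Data.Nat.Tactic.RingSolver using (solve-∀; solve)
open import Data.List.Relation.Unary.Unique.DecPropositional.Properties ℕ._≟_ using (deduplicate-!)
open import Algebra.Properties.CommutativeMonoid.Sum ℕ.+-0-commutativeMonoid
  using (sum; sum-syntax; sum-cong-≗; ∑-distrib-+; ∑-comm)
open import Data.Product.Base using (∃; ∃-syntax; _×_; _,_; proj₁; proj₂)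
open import Data.Sum.Base using (_⊎_; inj₁; inj₂)
open import Function.Base using (_∘_; _∘₂_; id)
open import Relation.Binary.Definitions using (tri<; tri≈; tri>)
open import Relation.Binary.PropositionalEquality
  using (_≡_; _≢_; refl; sym; trans; cong; cong₂; subst; subst₂; module ≡-Reasoning)
open import Relation.Nullary.Decidable
  using (Dec; yes; no; does; _×-dec_; ¬?; dec-true; dec-false; decidable-stable)
open import Relation.Nullary.Negation using (¬_; contradiction)
open import Relation.Unary using (Pred; Decidable)

open import Defs
  using (Graph; Coloring; adj; col; edges; e; c; Rainbow; RainbowTriangle; ExactlyOneRainbowTriangle; Complete)

private variable n m : ℕ

𝟙 : Bool → ℕ
𝟙 true = 1
𝟙 false = 0

𝟙≤1 : ∀ b → 𝟙 b ≤ 1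
𝟙≤1 true = ℕ.≤-refl
𝟙≤1 false = z≤n

count : (Fin n → Bool) → ℕ
count p = sum (𝟙 ∘ p)

sum-mono-≤ : {f g : Fin n → ℕ} → (∀ i → f i ≤ g i) → sum f ≤ sum g
sum-mono-≤ {zero} f≤g = z≤n
sum-mono-≤ {suc n} f≤g = ℕ.+-mono-≤ (f≤g zero) (sum-mono-≤ (f≤g ∘ suc))

sum-split : {f g h : Fin n → ℕ} → (∀ i → f i ≡ g i + h i) → sum f ≡ sum g + sum h
sum-split {g = g} {h} f≡g+h = trans (sum-cong-≗ f≡g+h) (∑-distrib-+ g h)

sum-split-at : {f g : Fin n → ℕ} {d : ℕ} (v : Fin n) → f v ≡ g v + d → (∀ i → i ≢ v → f i ≡ g i) →
               sum f ≡ sum g + d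
sum-split-at {suc n} {f} {g} {d} zero fv≡gv+d f≡g = begin
  f zero + sum (f ∘ suc)       ≡⟨ cong₂ _+_ fv≡gv+d (sum-cong-≗ (λ i → f≡g (suc i) λ ())) ⟩
  g zero + d + sum (g ∘ suc)   ≡⟨ ℕ.+-assoc (g zero) d _ ⟩
  g zero + (d + sum (g ∘ suc)) ≡⟨ cong (g zero +_) (ℕ.+-comm d _) ⟩
  g zero + (sum (g ∘ suc) + d) ≡⟨ ℕ.+-assoc (g zero) _ d ⟨
  g zero + sum (g ∘ suc) + d   ∎
  where open ≡-Reasoning
sum-split-at {suc n} {f} {g} (suc v) fv≡gv+d f≡g =
  trans (cong₂ _+_ (f≡g zero λ ()) (sum-split-at v fv≡gv+d (λ i i≢v → f≡g (suc i) (i≢v ∘ suc-injective))))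
        (sym (ℕ.+-assoc (g zero) _ _))

sum-zero : {f : Fin n → ℕ} → (∀ i → f i ≡ 0) → sum f ≡ 0
sum-zero {zero} _ = refl
sum-zero {suc n} f≡0 rewrite f≡0 zero = sum-zero (f≡0 ∘ suc)

≤-sum : (f : Fin n → ℕ) (i : Fin n) → f i ≤ sum f
≤-sum f zero = ℕ.m≤m+n (f zero) _
≤-sum f (suc i) = ℕ.≤-trans (≤-sum (f ∘ suc) i) (ℕ.m≤n+m _ (f zero))

count-positive : (p : Fin n → Bool) → 0 < count p → ∃ λ i → p i ≡ true
count-positive {suc n} p 0<count with p zero in eq
... | true = zero , eq
... | false with count-positive (p ∘ suc) 0<count
...   | i , pi = suc i , pi

count-all : ∀ n → count {n} (λ _ → true) ≡ n
count-all zero = refl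
count-all (suc n) = cong suc (count-all n)

from-does : ∀ {p} {P : Set p} (P? : Dec P) → does P? ≡ true → P
from-does (yes p) _ = p

𝟙-does-⇔ : ∀ {p q} {P : Set p} {Q : Set q} (P? : Dec P) (Q? : Dec Q) → (P → Q) → (Q → P) →
           𝟙 (does P?) ≡ 𝟙 (does Q?)
𝟙-does-⇔ (yes _) (yes _) _ _ = refl
𝟙-does-⇔ (yes p) (no ¬q) P⇒Q _ = contradiction (P⇒Q p) ¬q
𝟙-does-⇔ (no ¬p) (yes q) _ Q⇒P = contradiction (Q⇒P q) ¬p
𝟙-does-⇔ (no _) (no _) _ _ = refl

𝟙-cover : ∀ {p r} {P : Set p} {R : Set r} (P? : Dec P) (q : Bool) (R? : Dec R) →
          (P → q ≡ true ⊎ R) → 𝟙 (does P?) ≤ 𝟙 q + 𝟙 (does R?)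
𝟙-cover (no _) q R? cover = z≤n
𝟙-cover (yes p) q R? cover with cover p
... | inj₁ refl = s≤s z≤n
... | inj₂ r = ℕ.≤-trans (ℕ.≤-reflexive (cong 𝟙 (sym (dec-true R? r)))) (ℕ.m≤n+m _ (𝟙 q))

𝟙-forced : ∀ {a b} q → suc a ≤ b + 𝟙 q → b ≤ a → q ≡ true × a ≤ b
𝟙-forced {a} {b} true a<b+1 _ = refl , ℕ.≤-pred (ℕ.≤-trans a<b+1 (ℕ.≤-reflexive (ℕ.+-comm b 1)))
𝟙-forced {a} {b} false a<b b≤a =
  contradiction (ℕ.≤-trans a<b (ℕ.≤-trans (ℕ.≤-reflexive (ℕ.+-identityʳ b)) b≤a)) (ℕ.<-irrefl refl)

count-subsingleton : ∀ {p} {P : Pred (Fin n) p} (P? : Decidable P) (b : Bool) →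
                     (∀ {i j} → P i → P j → i ≡ j) → (∀ {i} → P i → b ≡ true) →
                     count (does ∘ P?) ≤ 𝟙 b
count-subsingleton {zero} P? b unique P⇒b = z≤n
count-subsingleton {suc n} P? b unique P⇒b with P? zero
... | yes P0 rewrite P⇒b P0 =
  s≤s (count-subsingleton (P? ∘ suc) false (suc-injective ∘₂ unique) (λ Psi → contradiction (unique P0 Psi) λ ()))
... | no _ = count-subsingleton (P? ∘ suc) b (suc-injective ∘₂ unique) P⇒b

𝟙∃≤count : ∀ {p} {P : Pred (Fin n) p} (P? : Decidable P) → 𝟙 (does (any? P?)) ≤ count (does ∘ P?)
𝟙∃≤count P? with any? P?
... | no _ = z≤n
... | yes (i , Pi) = ℕ.≤-trans (ℕ.≤-reflexive (cong 𝟙 (sym (dec-true (P? i) Pi)))) (≤-sum (𝟙 ∘ does ∘ P?) i)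

count-image-≤ : ∀ {p} {Q : Pred (Fin n) p} (Q? : Decidable Q) (f : Fin n → ℕ) →
                count {m} (λ κ → does (any? λ w → Q? w ×-dec (f w ℕ.≟ toℕ κ))) ≤ count (does ∘ Q?)
count-image-≤ {n} {m} {Q = Q} Q? f = begin
  count (λ κ → does (any? (R? κ)))         ≤⟨ sum-mono-≤ (λ κ → 𝟙∃≤count (R? κ)) ⟩
  ∑[ κ < m ] ∑[ w < n ] 𝟙 (does (R? κ w))  ≡⟨ ∑-comm (λ κ w → 𝟙 (does (R? κ w))) ⟩
  ∑[ w < n ] ∑[ κ < m ] 𝟙 (does (R? κ w))  ≤⟨ sum-mono-≤ (λ w → count-subsingleton (λ κ → R? κ w) _ same-image
                                                                     (dec-true (Q? w) ∘ proj₁)) ⟩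
  count (does ∘ Q?)                         ∎
  where
  open ℕ.≤-Reasoning
  R? : ∀ κ w → Dec (Q w × f w ≡ toℕ κ)
  R? κ w = Q? w ×-dec (f w ℕ.≟ toℕ κ)
  same-image : ∀ {w κ κ′} → Q w × f w ≡ toℕ κ → Q w × f w ≡ toℕ κ′ → κ ≡ κ′
  same-image (_ , fw≡κ) (_ , fw≡κ′) = toℕ-injective (trans (sym fw≡κ) fw≡κ′)

module _ {a} {A : Set a} where
  open import Data.List.Relation.Unary.All using (_∷_; [])
  open import Data.List.Relation.Unary.AllPairs using (_∷_; [])

  ∈-─ : ∀ {x y : A} {ys} (x∈ys : x ∈ ys) → y ∈ ys → y ≢ x → y ∈ (ys ─ x∈ys)
  ∈-─ (here refl) (here refl) y≢x = contradiction refl y≢x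
  ∈-─ (here refl) (there y∈ys) _ = y∈ys
  ∈-─ (there x∈ys) (here refl) _ = here refl
  ∈-─ (there x∈ys) (there y∈ys) y≢x = there (∈-─ x∈ys y∈ys y≢x)

  unique⊆⇒length≤ : ∀ {xs ys : List A} → Unique xs → (∀ {z} → z ∈ xs → z ∈ ys) → length xs ≤ length ys
  unique⊆⇒length≤ {[]} _ _ = z≤n
  unique⊆⇒length≤ {x ∷ xs} {ys} (x∉xs ∷ unique) xs⊆ys = ℕ.≤-trans
    (s≤s (unique⊆⇒length≤ unique λ z∈xs → ∈-─ x∈ys (xs⊆ys (there z∈xs)) (All.lookup x∉xs z∈xs ∘ sym)))
    (ℕ.≤-reflexive (sym (length-removeAt′ ys _)))
    where x∈ys = xs⊆ys (here refl)

  no-four-distinct : ∀ {ts : List A} {a b c d} → length ts ≤ 3 → a ∈ ts → b ∈ ts → c ∈ ts → d ∈ ts →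
                     a ≢ b → a ≢ c → a ≢ d → b ≢ c → b ≢ d → c ≢ d → ⊥
  no-four-distinct ts≤3 a∈ b∈ c∈ d∈ a≢b a≢c a≢d b≢c b≢d c≢d = ℕ.≤⇒≯ ts≤3
    (unique⊆⇒length≤ ((a≢b ∷ a≢c ∷ a≢d ∷ []) ∷ (b≢c ∷ b≢d ∷ []) ∷ (c≢d ∷ []) ∷ [] ∷ []) ⊆ts)
    where
    ⊆ts : ∀ {z} → z ∈ _ → z ∈ _
    ⊆ts (here refl) = a∈
    ⊆ts (there (here refl)) = b∈
    ⊆ts (there (there (here refl))) = c∈
    ⊆ts (there (there (there (here refl)))) = d∈

module _ {a p} {A : Set a} {P : Pred A p} (P? : Decidable P) where

  length-filter-tabulate : (h : Fin m → A) → length (filter P? (tabulate h)) ≡ count (does ∘ P? ∘ h)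
  length-filter-tabulate {zero} h = refl
  length-filter-tabulate {suc m} h with P? (h zero)
  ... | yes _ = cong suc (length-filter-tabulate (h ∘ suc))
  ... | no _ = length-filter-tabulate (h ∘ suc)

  length-filter-concatMap : ∀ {b} {B : Set b} (f : B → List A) (h : Fin m → B) →
                            length (filter P? (concatMap f (tabulate h))) ≡ ∑[ i < m ] length (filter P? (f (h i)))
  length-filter-concatMap {zero} f h = refl
  length-filter-concatMap {suc m} f h = begin
    length (filter P? (f (h zero) ++ concatMap f (tabulate (h ∘ suc))))
      ≡⟨ cong length (filter-++ P? (f (h zero)) _) ⟩
    length (filter P? (f (h zero)) ++ filter P? (concatMap f (tabulate (h ∘ suc))))
      ≡⟨ length-++ (filter P? (f (h zero))) ⟩
    length (filter P? (f (h zero))) + length (filter P? (concatMap f (tabulate (h ∘ suc))))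
      ≡⟨ cong (length (filter P? (f (h zero))) +_) (length-filter-concatMap f (h ∘ suc)) ⟩
    ∑[ i < suc m ] length (filter P? (f (h i))) ∎
    where open ≡-Reasoning

module _ where
  open import Data.List.Membership.DecPropositional ℕ._≟_ using (_∈?_)
  open import Data.List.Relation.Unary.All using (_∷_)
  open import Data.List.Relation.Unary.AllPairs using (_∷_)

  length-unique : ∀ {B} (ys : List ℕ) → Unique ys → All (_< B) ys →
                  length ys ≡ count {B} (λ κ → does (toℕ κ ∈? ys))
  length-unique {B} [] _ _ = sym (sum-zero {n = B} λ _ → refl)
  length-unique {B} (y ∷ ys) (y≢ys ∷ unique) (y<B ∷ ys<B) = begin
    suc (length ys)                                ≡⟨ cong suc (length-unique ys unique ys<B) ⟩
    suc (count {B} (λ κ → does (toℕ κ ∈? ys)))     ≡⟨ ℕ.+-comm 1 _ ⟩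
    count {B} (λ κ → does (toℕ κ ∈? ys)) + 1       ≡⟨ sum-split-at κ₀ at-κ₀ away ⟨
    count {B} (λ κ → does (toℕ κ ∈? y ∷ ys))       ∎
    where
    open ≡-Reasoning
    κ₀ : Fin B
    κ₀ = fromℕ< y<B
    y∉ys : ¬ y ∈ ys
    y∉ys y∈ys = All.lookup y≢ys y∈ys refl
    at-κ₀ : 𝟙 (does (toℕ κ₀ ∈? y ∷ ys)) ≡ 𝟙 (does (toℕ κ₀ ∈? ys)) + 1
    at-κ₀ = trans (cong 𝟙 (dec-true (toℕ κ₀ ∈? y ∷ ys) (here (toℕ-fromℕ< y<B))))
                  (cong (λ b → 𝟙 b + 1) (sym (dec-false (toℕ κ₀ ∈? ys) (y∉ys ∘ subst (_∈ ys) (toℕ-fromℕ< y<B)))))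
    away : ∀ κ → κ ≢ κ₀ → 𝟙 (does (toℕ κ ∈? y ∷ ys)) ≡ 𝟙 (does (toℕ κ ∈? ys))
    away κ κ≢κ₀ = 𝟙-does-⇔ (toℕ κ ∈? y ∷ ys) (toℕ κ ∈? ys) (λ where
      (here κ≡y) → contradiction (toℕ-injective (trans κ≡y (sym (toℕ-fromℕ< y<B)))) κ≢κ₀
      (there κ∈ys) → κ∈ys) there

slack-gap : ∀ k w g s s′ → suc k * suc (suc k) < w + 2 * g + 2 * s → w + 2 * s′ ≤ k * suc k → suc k + s′ < g + s
slack-gap k w g s s′ big small = ℕ.*-cancelˡ-< 2 _ _ (ℕ.+-cancelˡ-< w _ _ (begin-strict
  w + 2 * (suc k + s′)      ≡⟨ solve (w ∷ k ∷ s′ ∷ []) ⟩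
  w + 2 * s′ + 2 * suc k    ≤⟨ ℕ.+-monoˡ-≤ (2 * suc k) small ⟩
  k * suc k + 2 * suc k     ≡⟨ solve (k ∷ []) ⟩
  suc k * suc (suc k)       <⟨ big ⟩
  w + 2 * g + 2 * s         ≡⟨ solve (w ∷ g ∷ s ∷ []) ⟩
  w + 2 * (g + s)           ∎))
  where open ℕ.≤-Reasoning

slack-gap⇒bound : ∀ d N o s s′ t p → suc (d + N) + s′ < d + o + s → t + s ≤ s′ + p → 2 + N + t ≤ o + p
slack-gap⇒bound d N o s s′ t p gap t+s≤s′+p = ℕ.+-cancelʳ-≤ s _ _ (begin
  2 + N + t + s     ≡⟨ solve (N ∷ t ∷ s ∷ []) ⟩
  2 + N + (t + s)   ≤⟨ ℕ.+-monoʳ-≤ (2 + N) t+s≤s′+p ⟩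
  2 + N + (s′ + p)  ≡⟨ solve (N ∷ s′ ∷ p ∷ []) ⟩
  2 + N + s′ + p    ≤⟨ ℕ.+-monoˡ-≤ p (ℕ.+-cancelˡ-≤ d _ _ (begin
    d + (2 + N + s′)        ≡⟨ solve (d ∷ N ∷ s′ ∷ []) ⟩
    suc (suc (d + N) + s′)  ≤⟨ gap ⟩
    d + o + s               ≡⟨ ℕ.+-assoc d o s ⟩
    d + (o + s)             ∎)) ⟩
  o + s + p         ≡⟨ solve (o ∷ s ∷ p ∷ []) ⟩
  o + p + s         ∎)
  where open ℕ.≤-Reasoning

double-choose-2 : ∀ n → 2 * (suc n C 2) ≡ n * suc n
double-choose-2 zero = refl
double-choose-2 (suc n) = begin
  2 * (suc (suc n) C 2)            ≡⟨ cong (2 *_) (nCk+nC[k+1]≡[n+1]C[k+1] (suc n) 1) ⟨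
  2 * (suc n C 1 + suc n C 2)      ≡⟨ cong (λ k → 2 * (k + suc n C 2)) (nC1≡n (suc n)) ⟩
  2 * (suc n + suc n C 2)          ≡⟨ ℕ.*-distribˡ-+ 2 (suc n) (suc n C 2) ⟩
  2 * suc n + 2 * (suc n C 2)      ≡⟨ cong (2 * suc n +_) (double-choose-2 n) ⟩
  2 * suc n + n * suc n            ≡⟨ solve (n ∷ []) ⟩
  suc n * suc (suc n)              ∎
  where open ≡-Reasoning

-- Induced subgraphs

module _ {n : ℕ} where

  VSet : Set
  VSet = Fin n → Bool

  _∖_ : VSet → Fin n → VSet
  (S ∖ v) i = if does (i ≟ v) then false else S i

  ∣_∣ : VSet → ℕ
  ∣ S ∣ = count S

  ∖-self : ∀ S v → (S ∖ v) v ≡ false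
  ∖-self S v with v ≟ v
  ... | yes _ = refl
  ... | no v≢v = contradiction refl v≢v

  ∖-other : ∀ S {v i} → i ≢ v → (S ∖ v) i ≡ S i
  ∖-other S {v} {i} i≢v with i ≟ v
  ... | yes i≡v = contradiction i≡v i≢v
  ... | no _ = refl

  ∖-⊆ : ∀ S {v i} → (S ∖ v) i ≡ true → S i ≡ true
  ∖-⊆ S {v} {i} Si with i ≟ v
  ... | no _ = Si

  ∖-≢ : ∀ S {v i} → (S ∖ v) i ≡ true → i ≢ v
  ∖-≢ S {v} {i} Si i≡v with i ≟ v
  ... | no i≢v = i≢v i≡v

  ∖-keeps : ∀ S {v i} → S i ≡ true → i ≢ v → (S ∖ v) i ≡ true
  ∖-keeps S Si i≢v = trans (∖-other S i≢v) Si

  size-remove : ∀ S {v} → S v ≡ true → ∣ S ∣ ≡ suc ∣ S ∖ v ∣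
  size-remove S {v} Sv = trans (sum-split-at v at-v (λ i i≢v → cong 𝟙 (sym (∖-other S i≢v)))) (ℕ.+-comm _ 1)
    where
    at-v : 𝟙 (S v) ≡ 𝟙 ((S ∖ v) v) + 1
    at-v rewrite ∖-self S v | Sv = refl

  size-∖ : ∀ S {v m} → S v ≡ true → ∣ S ∣ ≡ suc m → ∣ S ∖ v ∣ ≡ m
  size-∖ S Sv ∣S∣≡1+m = ℕ.suc-injective (trans (sym (size-remove S Sv)) ∣S∣≡1+m)

  two-members : ∀ S {a b : Fin n} → S a ≡ true → S b ≡ true → a ≢ b → 2 ≤ ∣ S ∣
  two-members S {a} {b} Sa Sb a≢b = ℕ.≤-trans
    (s≤s (ℕ.≤-trans (ℕ.≤-reflexive (cong 𝟙 (sym (∖-keeps S Sb (a≢b ∘ sym))))) (≤-sum (𝟙 ∘ (S ∖ a)) b)))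
    (ℕ.≤-reflexive (sym (size-remove S Sa)))

module InducedSubgraphs {n : ℕ} (G : Graph n) (χ : Coloring G) where

  open import Data.List.Membership.DecPropositional (_≟_ {n}) using (_∈?_)

  adj⇒≢ : ∀ {a b} → adj G a b ≡ true → a ≢ b
  adj⇒≢ {a} ab refl with trans (sym (Graph.irrefl G a)) ab
  ... | ()

  deg : VSet → Fin n → ℕ
  deg S v = count (λ w → S w ∧ adj G v w)

  nondeg : VSet → Fin n → ℕ
  nondeg S v = count (λ w → (S ∖ v) w ∧ not (adj G v w))

  degSum : VSet → ℕ
  degSum S = sum (λ i → 𝟙 (S i) * deg S i)

  size-neighbourhood : ∀ S {v} → S v ≡ true → ∣ S ∣ ≡ suc (deg S v + nondeg S v)
  size-neighbourhood S {v} Sv = trans (sum-split-at v at-v away)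
    (trans (ℕ.+-comm _ 1) (cong suc (∑-distrib-+ (λ w → 𝟙 (S w ∧ adj G v w)) _)))
    where
    at-v : 𝟙 (S v) ≡ 𝟙 (S v ∧ adj G v v) + 𝟙 ((S ∖ v) v ∧ not (adj G v v)) + 1
    at-v rewrite ∖-self S v | Sv | Graph.irrefl G v = refl
    away : ∀ w → w ≢ v → 𝟙 (S w) ≡ 𝟙 (S w ∧ adj G v w) + 𝟙 ((S ∖ v) w ∧ not (adj G v w))
    away w w≢v rewrite ∖-other S w≢v with S w | adj G v w
    ... | true  | true  = refl
    ... | true  | false = refl
    ... | false | _     = refl

  deg-remove : ∀ S {v} i → S v ≡ true → deg S i ≡ deg (S ∖ v) i + 𝟙 (adj G i v)
  deg-remove S {v} i Sv = sum-split-at v at-v away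
    where
    at-v : 𝟙 (S v ∧ adj G i v) ≡ 𝟙 ((S ∖ v) v ∧ adj G i v) + 𝟙 (adj G i v)
    at-v rewrite ∖-self S v | Sv = refl
    away : ∀ w → w ≢ v → 𝟙 (S w ∧ adj G i w) ≡ 𝟙 ((S ∖ v) w ∧ adj G i w)
    away w w≢v = cong (λ b → 𝟙 (b ∧ adj G i w)) (sym (∖-other S w≢v))

  degSum-remove : ∀ S {v} → S v ≡ true → degSum S ≡ degSum (S ∖ v) + 2 * deg S v
  degSum-remove S {v} Sv = begin
    degSum S
      ≡⟨ sum-split-at v at-v away ⟩
    sum (λ i → 𝟙 ((S ∖ v) i) * deg (S ∖ v) i + 𝟙 (S i ∧ adj G v i)) + deg S v
      ≡⟨ cong (_+ deg S v) (∑-distrib-+ (λ i → 𝟙 ((S ∖ v) i) * deg (S ∖ v) i) _) ⟩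
    degSum (S ∖ v) + deg S v + deg S v
      ≡⟨ ℕ.+-assoc (degSum (S ∖ v)) (deg S v) (deg S v) ⟩
    degSum (S ∖ v) + (deg S v + deg S v)
      ≡⟨ cong (λ d → degSum (S ∖ v) + (deg S v + d)) (ℕ.+-identityʳ (deg S v)) ⟨
    degSum (S ∖ v) + 2 * deg S v
      ∎
    where
    open ≡-Reasoning
    at-v : 𝟙 (S v) * deg S v ≡ 𝟙 ((S ∖ v) v) * deg (S ∖ v) v + 𝟙 (S v ∧ adj G v v) + deg S v
    at-v rewrite ∖-self S v | Sv | Graph.irrefl G v = ℕ.+-identityʳ (deg S v)
    away : ∀ i → i ≢ v → 𝟙 (S i) * deg S i ≡ 𝟙 ((S ∖ v) i) * deg (S ∖ v) i + 𝟙 (S i ∧ adj G v i)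
    away i i≢v rewrite ∖-other S i≢v with S i
    ... | false = refl
    ... | true rewrite ℕ.*-identityˡ (deg S i) | ℕ.*-identityˡ (deg (S ∖ v) i) | Graph.sym G v i =
      deg-remove S i Sv

  Occurs : VSet → ℕ → Set
  Occurs S κ = ∃[ i ] ∃[ j ] S i ≡ true × S j ≡ true × adj G i j ≡ true × col χ i j ≡ κ

  occurs? : ∀ S κ → Dec (Occurs S κ)
  occurs? S κ = any? λ i → any? λ j →
    (S i Bool.≟ true) ×-dec (S j Bool.≟ true) ×-dec (adj G i j Bool.≟ true) ×-dec (col χ i j ℕ.≟ κ)

  Private : VSet → Fin n → ℕ → Set
  Private S v κ = Occurs S κ × ¬ Occurs (S ∖ v) κ

  private? : ∀ S v κ → Dec (Private S v κ)
  private? S v κ = occurs? S κ ×-dec ¬? (occurs? (S ∖ v) κ)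

  -- Every colour is below palette, so the colours of S are counted as elements of Fin palette.
  palette : ℕ
  palette = suc (∑[ i < n ] ∑[ j < n ] col χ i j)

  colours : VSet → ℕ
  colours S = count {palette} λ κ → does (occurs? S (toℕ κ))

  own : VSet → Fin n → ℕ
  own S v = count {palette} λ κ → does (private? S v (toℕ κ))

  occurs-∖ : ∀ S {v κ} → Occurs (S ∖ v) κ → Occurs S κ
  occurs-∖ S (i , j , Si , Sj , ij , ij≡κ) = i , j , ∖-⊆ S Si , ∖-⊆ S Sj , ij , ij≡κ

  colours-remove : ∀ S v → colours S ≡ colours (S ∖ v) + own S v
  colours-remove S v =
    sum-split {n = palette} {g = 𝟙 ∘ does ∘ occurs? (S ∖ v) ∘ toℕ} {h = 𝟙 ∘ does ∘ private? S v ∘ toℕ}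
      λ κ → split (occurs? S (toℕ κ)) (occurs? (S ∖ v) (toℕ κ))
    where
    split : ∀ {κ} (o : Dec (Occurs S κ)) (o′ : Dec (Occurs (S ∖ v) κ)) →
            𝟙 (does o) ≡ 𝟙 (does o′) + 𝟙 (does (o ×-dec ¬? o′))
    split (yes _) (yes _) = refl
    split (yes _) (no _) = refl
    split (no ¬o) (yes o′) = contradiction (occurs-∖ S o′) ¬o
    split (no _) (no _) = refl

  weight : VSet → ℕ
  weight S = degSum S + 2 * colours S

  weight-remove : ∀ S {v} → S v ≡ true → weight S ≡ weight (S ∖ v) + 2 * (deg S v + own S v)
  weight-remove S {v} Sv rewrite degSum-remove S Sv | colours-remove S v =
    rearrange (degSum (S ∖ v)) (deg S v) (colours (S ∖ v)) (own S v)
    where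
    rearrange : ∀ a d k o → a + 2 * d + 2 * (k + o) ≡ a + 2 * k + 2 * (d + o)
    rearrange = solve-∀

  weight-trivial : ∀ S → ∣ S ∣ ≤ 1 → weight S ≡ 0
  weight-trivial S ∣S∣≤1 = cong₂ _+_ (sum-zero {n = n} no-degree) (cong (2 *_) (sum-zero {n = palette} no-colour))
    where
    no-degree : ∀ i → 𝟙 (S i) * deg S i ≡ 0
    no-degree i with S i in Si
    ... | false = refl
    ... | true = trans (ℕ.*-identityˡ _)
      (ℕ.n≤0⇒n≡0 (ℕ.m+n≤o⇒m≤o _ (ℕ.≤-pred (ℕ.≤-trans (ℕ.≤-reflexive (sym (size-neighbourhood S Si))) ∣S∣≤1))))
    no-colour : ∀ (κ : Fin palette) → 𝟙 (does (occurs? S (toℕ κ))) ≡ 0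
    no-colour κ = cong 𝟙 (dec-false (occurs? S (toℕ κ)) λ (_ , _ , Si , Sj , ij , _) →
      ℕ.<-irrefl refl (ℕ.≤-trans (two-members S Si Sj (adj⇒≢ ij)) ∣S∣≤1))

  Rainbow△ : Fin n → Fin n → Fin n → Set
  Rainbow△ a b c = adj G a b ≡ true × adj G b c ≡ true × adj G a c ≡ true × Rainbow χ a b c

  △-swap₁₂ : ∀ {a b c} → Rainbow△ a b c → Rainbow△ b a c
  △-swap₁₂ {a} {b} (ab , bc , ac , ab≢bc , ab≢ac , bc≢ac) =
    trans (Graph.sym G b a) ab , ac , bc ,
    ab≢ac ∘ trans (Coloring.colSym χ a b) , ab≢bc ∘ trans (Coloring.colSym χ a b) , bc≢ac ∘ sym

  △-swap₂₃ : ∀ {a b c} → Rainbow△ a b c → Rainbow△ a c b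
  △-swap₂₃ {a} {b} {c} (ab , bc , ac , ab≢bc , ab≢ac , bc≢ac) =
    ac , trans (Graph.sym G c b) bc , ab , (λ ac≡cb → bc≢ac (sym (trans ac≡cb (Coloring.colSym χ c b)))) ,
    ab≢ac ∘ sym , (λ cb≡ab → ab≢bc (sym (trans (Coloring.colSym χ b c) cb≡ab)))

  RainbowTrappedIn : VSet → List (Fin n) → Set
  RainbowTrappedIn S ts = ∀ {a b c} → S a ≡ true → S b ≡ true → S c ≡ true → Rainbow△ a b c →
                          a ∈ ts × b ∈ ts × c ∈ ts

  RainbowFree : VSet → Set
  RainbowFree S = RainbowTrappedIn S []

  Independent : List (Fin n) → Set
  Independent ps = ∀ {x y} → x ∈ ps → y ∈ ps → adj G x y ≡ false

  NonEdge : VSet → Fin n → Fin n → Set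
  NonEdge S a b = S a ≡ true × S b ≡ true × a ≢ b × adj G a b ≡ false

  private-avoids : ∀ S {u κ a b} → Private S u κ → S a ≡ true → S b ≡ true → a ≢ u → b ≢ u →
                   adj G a b ≡ true → col χ a b ≢ κ
  private-avoids S (_ , unseen) Sa Sb a≢u b≢u ab refl =
    unseen (_ , _ , ∖-keeps S Sa a≢u , ∖-keeps S Sb b≢u , ab , refl)

  private-edge : ∀ S {u κ} → Private S u κ → ∃[ x ] S u ≡ true × S x ≡ true × adj G u x ≡ true × col χ u x ≡ κ
  private-edge S {u} ((i , j , Si , Sj , ij , ij≡κ) , unseen) with i ≟ u | j ≟ u
  ... | yes refl | _ = j , Si , Sj , ij , ij≡κ
  ... | no _ | yes refl = i , Sj , Si , trans (Graph.sym G j i) ij , trans (Coloring.colSym χ j i) ij≡κ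
  ... | no i≢u | no j≢u = contradiction (i , j , ∖-keeps S Si i≢u , ∖-keeps S Sj j≢u , ij , ij≡κ) unseen

  -- The extremal argument

  module HeavyVertices (S : VSet) {ts ps : List (Fin n)}
    (trapped : RainbowTrappedIn S ts) (ts≤3 : length ts ≤ 3) (independent : Independent ps)
    (heavy : ∀ {v} → S v ≡ true → 2 + nondeg S v + 𝟙 (does (v ∈? ts)) ≤ own S v + 𝟙 (does (v ∈? ps)))
    where

    module _ {u x} (Su : S u ≡ true) (Sx : S x ≡ true) (ux : adj G u x ≡ true)
                   (c₀-private : Private S u (col χ u x)) where

      c₀ : ℕ
      c₀ = col χ u x

      Leaf : Fin n → Set
      Leaf w = S w ≡ true × adj G u w ≡ true × Private S u (col χ u w) × col χ u w ≢ c₀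

      leaf? : ∀ w → Dec (Leaf w)
      leaf? w = (S w Bool.≟ true) ×-dec (adj G u w Bool.≟ true) ×-dec private? S u (col χ u w)
                ×-dec ¬? (col χ u w ℕ.≟ c₀)

      x-leaf? : ∀ w → Dec (Leaf w × adj G x w ≡ true)
      x-leaf? w = leaf? w ×-dec (adj G x w Bool.≟ true)

      leaf-colour? : ∀ (κ : Fin palette) → Dec (∃[ w ] Leaf w × col χ u w ≡ toℕ κ)
      leaf-colour? κ = any? λ w → leaf? w ×-dec (col χ u w ℕ.≟ toℕ κ)

      is-c₀ : Fin palette → Bool
      is-c₀ κ = does (toℕ κ ℕ.≟ c₀)

      x≢u : x ≢ u
      x≢u = adj⇒≢ ux ∘ sym

      x-leaf-rainbow : ∀ {w} → Leaf w → adj G x w ≡ true → Rainbow△ u x w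
      x-leaf-rainbow (Sw , uw , c-private , c≢c₀) xw =
        ux , xw , uw , (λ c₀≡ → private-avoids S c₀-private Sx Sw x≢u w≢u xw (sym c₀≡)) ,
        c≢c₀ ∘ sym , private-avoids S c-private Sx Sw x≢u w≢u xw
        where w≢u = adj⇒≢ uw ∘ sym

      own-split : ∀ κ → 𝟙 (does (private? S u (toℕ κ))) ≤ 𝟙 (is-c₀ κ) + 𝟙 (does (leaf-colour? κ))
      own-split κ = 𝟙-cover (private? S u (toℕ κ)) _ (leaf-colour? κ) cover
        where
        cover : Private S u (toℕ κ) → is-c₀ κ ≡ true ⊎ ∃[ w ] Leaf w × col χ u w ≡ toℕ κ
        cover κ-private with toℕ κ ℕ.≟ c₀ | private-edge S κ-private
        ... | yes κ≡c₀ | _ = inj₁ (dec-true (toℕ κ ℕ.≟ c₀) κ≡c₀)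
        ... | no κ≢c₀ | w , _ , Sw , uw , c≡κ =
          inj₂ (w , (Sw , uw , subst (Private S u) (sym c≡κ) κ-private , κ≢c₀ ∘ trans (sym c≡κ)) , c≡κ)

      leaf-split : ∀ w → 𝟙 (does (leaf? w)) ≤ 𝟙 ((S ∖ x) w ∧ not (adj G x w)) + 𝟙 (does (x-leaf? w))
      leaf-split w = 𝟙-cover (leaf? w) _ (x-leaf? w) cover
        where
        cover : Leaf w → ((S ∖ x) w ∧ not (adj G x w)) ≡ true ⊎ Leaf w × adj G x w ≡ true
        cover leaf@(Sw , _ , _ , c≢c₀) with adj G x w
        ... | true = inj₂ (leaf , refl)
        ... | false = inj₁ (cong (_∧ true) (∖-keeps S Sw λ { refl → c≢c₀ refl }))

      x-leaves≤1 : count (does ∘ x-leaf?) ≤ 𝟙 (does (x ∈? ts))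
      x-leaves≤1 = count-subsingleton x-leaf? _ unique (dec-true (x ∈? ts) ∘ proj₁ ∘ proj₂ ∘ in-ts)
        where
        in-ts : ∀ {w} → Leaf w × adj G x w ≡ true → u ∈ ts × x ∈ ts × w ∈ ts
        in-ts (leaf@(Sw , _) , xw) = trapped Su Sx Sw (x-leaf-rainbow leaf xw)
        unique : ∀ {w w′} → Leaf w × adj G x w ≡ true → Leaf w′ × adj G x w′ ≡ true → w ≡ w′
        unique {w} {w′} x-leaf@((_ , uw , _) , xw) x-leaf′@((_ , uw′ , _) , xw′) with w ≟ w′
        ... | yes w≡w′ = w≡w′
        ... | no w≢w′ =
          let u∈ , x∈ , w∈ = in-ts x-leaf ; _ , _ , w′∈ = in-ts x-leaf′ in
          ⊥-elim (no-four-distinct ts≤3 u∈ x∈ w∈ w′∈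
                   (x≢u ∘ sym) (adj⇒≢ uw) (adj⇒≢ uw′) (adj⇒≢ xw) (adj⇒≢ xw′) w≢w′)

      own-bound : own S u ≤ suc (nondeg S x + 𝟙 (does (x ∈? ts)))
      own-bound = begin
        own S u
          ≤⟨ sum-mono-≤ own-split ⟩
        sum (λ κ → 𝟙 (is-c₀ κ) + 𝟙 (does (leaf-colour? κ)))
          ≡⟨ ∑-distrib-+ (𝟙 ∘ is-c₀) (𝟙 ∘ does ∘ leaf-colour?) ⟩
        count is-c₀ + count (does ∘ leaf-colour?)
          ≤⟨ ℕ.+-mono-≤ (count-subsingleton (λ (κ : Fin palette) → toℕ κ ℕ.≟ c₀) true
                                            (λ κ≡c₀ κ′≡c₀ → toℕ-injective (trans κ≡c₀ (sym κ′≡c₀))) (λ _ → refl))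
                        (count-image-≤ {m = palette} leaf? (col χ u)) ⟩
        1 + count (does ∘ leaf?)
          ≤⟨ s≤s (sum-mono-≤ leaf-split) ⟩
        1 + sum (λ w → 𝟙 ((S ∖ x) w ∧ not (adj G x w)) + 𝟙 (does (x-leaf? w)))
          ≡⟨ cong suc (∑-distrib-+ (λ w → 𝟙 ((S ∖ x) w ∧ not (adj G x w))) (𝟙 ∘ does ∘ x-leaf?)) ⟩
        1 + (nondeg S x + count (does ∘ x-leaf?))
          ≤⟨ s≤s (ℕ.+-monoʳ-≤ (nondeg S x) x-leaves≤1) ⟩
        suc (nondeg S x + 𝟙 (does (x ∈? ts)))
          ∎
        where open ℕ.≤-Reasoning

      own-grows : suc (own S u) ≤ own S x + 𝟙 (does (x ∈? ps))
      own-grows = ℕ.≤-trans (s≤s own-bound) (heavy Sx)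

    own-positive : ∀ {v} → S v ≡ true → 0 < own S v
    own-positive {v} Sv = ℕ.+-cancelʳ-≤ 1 1 (own S v) (begin
      2                                     ≤⟨ ℕ.m≤m+n 2 _ ⟩
      2 + nondeg S v + 𝟙 (does (v ∈? ts))   ≤⟨ heavy Sv ⟩
      own S v + 𝟙 (does (v ∈? ps))         ≤⟨ ℕ.+-monoʳ-≤ (own S v) (𝟙≤1 _) ⟩
      own S v + 1                           ∎)
      where open ℕ.≤-Reasoning

    private-colour : ∀ {u} → 0 < own S u →
                     ∃[ x ] S u ≡ true × S x ≡ true × adj G u x ≡ true × Private S u (col χ u x)
    private-colour {u} 0<own =
      let κ , κ-private? = count-positive {n = palette} (does ∘ private? S u ∘ toℕ) 0<own
          κ-private = from-does (private? S u (toℕ κ)) κ-private?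
          x , Su , Sx , ux , c≡κ = private-edge S κ-private
      in x , Su , Sx , ux , subst (Private S u) (sym c≡κ) κ-private

    maximal-private-edge : ∀ {u x} → (∀ v → own S v ≤ own S u) → S u ≡ true → S x ≡ true →
                           adj G u x ≡ true → Private S u (col χ u x) → x ∈ ps × (∀ v → own S v ≤ own S x)
    maximal-private-edge {u} {x} maximal Su Sx ux c-private =
      let x∈ps , u≤x = 𝟙-forced {own S u} {own S x} (does (x ∈? ps)) (own-grows Su Sx ux c-private) (maximal x)
      in from-does (x ∈? ps) x∈ps , λ v → ℕ.≤-trans (maximal v) u≤x

    no-vertex : ∀ {v₀} → S v₀ ≡ true → ⊥
    no-vertex {v₀} Sv₀ =
      let x , Su , Sx , ux , c-private = private-colour (ℕ.≤-trans (own-positive Sv₀) (maximal v₀))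
          x∈ps , x-maximal = maximal-private-edge maximal Su Sx ux c-private
          z , _ , Sz , xz , c′-private = private-colour (own-positive Sx)
          z∈ps , _ = maximal-private-edge x-maximal Sx Sz xz c′-private
      in contradiction (trans (sym xz) (independent x∈ps z∈ps)) λ ()
      where
      maximal : ∀ v → own S v ≤ own S (argmax (own S) v₀ (allFin n))
      maximal v = All.lookup (f[xs]≤f[argmax] v₀ (allFin n)) (∈-allFin v)

  -- Induction on the vertex set

  -- weight S is 2 (e(S) + c(S)), so Slack S s says e(S) + c(S) + s ≤ (∣ S ∣ + 1) C 2.
  Slack : VSet → ℕ → Set
  Slack S s = weight S + 2 * s ≤ ∣ S ∣ * suc ∣ S ∣

  trivial-slack : ∀ S → ∣ S ∣ ≤ 1 → Slack S 0
  trivial-slack S ∣S∣≤1 rewrite weight-trivial S ∣S∣≤1 = z≤n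

  heavy-vertex : ∀ S {v s s′ t p} → S v ≡ true → ¬ Slack S s → Slack (S ∖ v) s′ → t + s ≤ s′ + p →
                 2 + nondeg S v + t ≤ own S v + p
  heavy-vertex S {v} {s} {s′} Sv ¬slack slack′ =
    slack-gap⇒bound (deg S v) (nondeg S v) (own S v) s s′ _ _
      (subst (λ k → k + s′ < deg S v + own S v + s) (trans (sym (size-remove S Sv)) (size-neighbourhood S Sv))
        (slack-gap ∣ S ∖ v ∣ (weight (S ∖ v)) (deg S v + own S v) s s′ big slack′))
    where
    big : suc ∣ S ∖ v ∣ * suc (suc ∣ S ∖ v ∣) < weight (S ∖ v) + 2 * (deg S v + own S v) + 2 * s
    big = subst₂ (λ k w → k * suc k < w + 2 * s) (size-remove S Sv) (weight-remove S Sv) (ℕ.≰⇒> ¬slack)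

  -- The hypothesis quantifies over all decisions of v ∈ ts and v ∈ ps, so that callers can
  -- evaluate the indicators by matching on them.
  slack-by-deletion : ∀ S {ts ps s v₀} → RainbowTrappedIn S ts → length ts ≤ 3 → Independent ps → S v₀ ≡ true →
    (∀ {v} → S v ≡ true → (v∈ts? : Dec (v ∈ ts)) (v∈ps? : Dec (v ∈ ps)) →
       ∃[ s′ ] Slack (S ∖ v) s′ × 𝟙 (does v∈ts?) + s ≤ s′ + 𝟙 (does v∈ps?)) →
    Slack S s
  slack-by-deletion S {ts} {ps} {s} trapped ts≤3 independent Sv₀ deletion =
    decidable-stable (weight S + 2 * s ℕ.≤? ∣ S ∣ * suc ∣ S ∣) λ ¬slack →
      HeavyVertices.no-vertex S trapped ts≤3 independent (heavy ¬slack) Sv₀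
    where
    heavy : ¬ Slack S s → ∀ {v} → S v ≡ true → 2 + nondeg S v + 𝟙 (does (v ∈? ts)) ≤ own S v + 𝟙 (does (v ∈? ps))
    heavy ¬slack {v} Sv = let _ , slack′ , budget = deletion Sv (v ∈? ts) (v ∈? ps) in
      heavy-vertex S Sv ¬slack slack′ budget

  trapped-∖ : ∀ S {ts v} → RainbowTrappedIn S ts → RainbowTrappedIn (S ∖ v) ts
  trapped-∖ S trapped Sa Sb Sc = trapped (∖-⊆ S Sa) (∖-⊆ S Sb) (∖-⊆ S Sc)

  rainbow-free-∖ : ∀ S {ts v} → RainbowTrappedIn S ts → length ts ≤ 3 → v ∈ ts → RainbowFree (S ∖ v)
  rainbow-free-∖ S trapped ts≤3 v∈ts Sa Sb Sc r@(ab , bc , ac , _) =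
    let a∈ , b∈ , c∈ = trapped (∖-⊆ S Sa) (∖-⊆ S Sb) (∖-⊆ S Sc) r in
    ⊥-elim (no-four-distinct ts≤3 a∈ b∈ c∈ v∈ts (adj⇒≢ ab) (adj⇒≢ ac) (∖-≢ S Sa) (adj⇒≢ bc) (∖-≢ S Sb) (∖-≢ S Sc))

  nonedge-∖ : ∀ S {a b v} → NonEdge S a b → ¬ v ∈ a ∷ b ∷ [] → NonEdge (S ∖ v) a b
  nonedge-∖ S (Sa , Sb , a≢b , ab) v∉ =
    ∖-keeps S Sa (λ a≡v → v∉ (here (sym a≡v))) , ∖-keeps S Sb (λ b≡v → v∉ (there (here (sym b≡v)))) , a≢b , ab

  nonedge-size : ∀ S {a b} → NonEdge S a b → 2 ≤ ∣ S ∣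
  nonedge-size S (Sa , Sb , a≢b , _) = two-members S Sa Sb a≢b

  nonedge-nonempty-∖ : ∀ S {a b v} → NonEdge S a b → S v ≡ true → 0 < ∣ S ∖ v ∣
  nonedge-nonempty-∖ S nonedge Sv =
    ℕ.≤-pred (ℕ.≤-trans (nonedge-size S nonedge) (ℕ.≤-reflexive (size-remove S Sv)))

  nonedge-independent : ∀ S {a b} → NonEdge S a b → Independent (a ∷ b ∷ [])
  nonedge-independent S {a} {b} (_ , _ , _ , ab) = λ where
    (here refl) (here refl) → Graph.irrefl G a
    (here refl) (there (here refl)) → ab
    (there (here refl)) (here refl) → trans (Graph.sym G b a) ab
    (there (here refl)) (there (here refl)) → Graph.irrefl G b

  rainbow-free-slack : ∀ S → RainbowFree S → 0 < ∣ S ∣ → Slack S 1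
  rainbow-free-slack S free 0<∣S∣ = by-size _ S refl free 0<∣S∣
    where
    by-size : ∀ m S → ∣ S ∣ ≡ m → RainbowFree S → 0 < m → Slack S 1
    by-size 1 S ∣S∣≡1 _ _ rewrite weight-trivial S (ℕ.≤-reflexive ∣S∣≡1) | ∣S∣≡1 = ℕ.≤-refl
    by-size (suc (suc m)) S ∣S∣≡2+m free _ =
      slack-by-deletion S free z≤n (λ ()) (proj₂ (count-positive S (subst (0 <_) (sym ∣S∣≡2+m) (s≤s z≤n))))
        (deletion (by-size (suc m)))
      where
      deletion : (∀ S′ → ∣ S′ ∣ ≡ suc m → RainbowFree S′ → 0 < suc m → Slack S′ 1) →
                 ∀ {v} → S v ≡ true → (v∈ts? : Dec (v ∈ [])) (v∈ps? : Dec (v ∈ [])) →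
                 ∃[ s′ ] Slack (S ∖ v) s′ × 𝟙 (does v∈ts?) + 1 ≤ s′ + 𝟙 (does v∈ps?)
      deletion ih {v} Sv (no _) (no _) =
        1 , ih (S ∖ v) (size-∖ S Sv ∣S∣≡2+m) (trapped-∖ S free) (s≤s z≤n) , ℕ.≤-refl

  rainbow-free-nonedge-slack : ∀ S {a b} → RainbowFree S → NonEdge S a b → Slack S 2
  rainbow-free-nonedge-slack S {a} {b} free nonedge = by-size _ S refl free nonedge
    where
    by-size : ∀ m S → ∣ S ∣ ≡ m → RainbowFree S → NonEdge S a b → Slack S 2
    by-size zero S ∣S∣≡0 _ nonedge = contradiction (subst (2 ≤_) ∣S∣≡0 (nonedge-size S nonedge)) λ ()
    by-size (suc m) S ∣S∣≡1+m free nonedge@(Sa , _) =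
      slack-by-deletion S free z≤n (nonedge-independent S nonedge) Sa (deletion (by-size m))
      where
      deletion : (∀ S′ → ∣ S′ ∣ ≡ m → RainbowFree S′ → NonEdge S′ a b → Slack S′ 2) →
                 ∀ {v} → S v ≡ true → (v∈ts? : Dec (v ∈ [])) (v∈ps? : Dec (v ∈ a ∷ b ∷ [])) →
                 ∃[ s′ ] Slack (S ∖ v) s′ × 𝟙 (does v∈ts?) + 2 ≤ s′ + 𝟙 (does v∈ps?)
      deletion _ {v} Sv (no _) (yes _) =
        1 , rainbow-free-slack (S ∖ v) (trapped-∖ S free) (nonedge-nonempty-∖ S nonedge Sv) , ℕ.≤-refl
      deletion ih {v} Sv (no _) (no v∉ab) =
        2 , ih (S ∖ v) (size-∖ S Sv ∣S∣≡1+m) (trapped-∖ S free) (nonedge-∖ S nonedge v∉ab) , ℕ.≤-refl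

  trapped-slack : ∀ S {ts} → RainbowTrappedIn S ts → length ts ≤ 3 → Slack S 0
  trapped-slack S {ts} trapped ts≤3 = by-size _ S refl trapped
    where
    by-size : ∀ m S → ∣ S ∣ ≡ m → RainbowTrappedIn S ts → Slack S 0
    by-size 0 S ∣S∣≡0 _ = trivial-slack S (ℕ.≤-trans (ℕ.≤-reflexive ∣S∣≡0) z≤n)
    by-size 1 S ∣S∣≡1 _ = trivial-slack S (ℕ.≤-reflexive ∣S∣≡1)
    by-size (suc (suc m)) S ∣S∣≡2+m trapped =
      slack-by-deletion S trapped ts≤3 (λ ()) (proj₂ (count-positive S (subst (0 <_) (sym ∣S∣≡2+m) (s≤s z≤n))))
        (deletion (by-size (suc m)))
      where
      deletion : (∀ S′ → ∣ S′ ∣ ≡ suc m → RainbowTrappedIn S′ ts → Slack S′ 0) →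
                 ∀ {v} → S v ≡ true → (v∈ts? : Dec (v ∈ ts)) (v∈ps? : Dec (v ∈ [])) →
                 ∃[ s′ ] Slack (S ∖ v) s′ × 𝟙 (does v∈ts?) + 0 ≤ s′ + 𝟙 (does v∈ps?)
      deletion _ {v} Sv (yes v∈ts) (no _) =
        1 , rainbow-free-slack (S ∖ v) (rainbow-free-∖ S trapped ts≤3 v∈ts)
              (subst (0 <_) (sym (size-∖ S Sv ∣S∣≡2+m)) (s≤s z≤n)) , ℕ.≤-refl
      deletion ih {v} Sv (no _) (no _) = 0 , ih (S ∖ v) (size-∖ S Sv ∣S∣≡2+m) (trapped-∖ S trapped) , ℕ.≤-refl

  trapped-nonedge-slack : ∀ S {ts a b} → RainbowTrappedIn S ts → length ts ≤ 3 → NonEdge S a b → Slack S 1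
  trapped-nonedge-slack S {ts} {a} {b} trapped ts≤3 nonedge = by-size _ S refl trapped nonedge
    where
    by-size : ∀ m S → ∣ S ∣ ≡ m → RainbowTrappedIn S ts → NonEdge S a b → Slack S 1
    by-size zero S ∣S∣≡0 _ nonedge = contradiction (subst (2 ≤_) ∣S∣≡0 (nonedge-size S nonedge)) λ ()
    by-size (suc m) S ∣S∣≡1+m trapped nonedge@(Sa , _) =
      slack-by-deletion S trapped ts≤3 (nonedge-independent S nonedge) Sa (deletion (by-size m))
      where
      deletion : (∀ S′ → ∣ S′ ∣ ≡ m → RainbowTrappedIn S′ ts → NonEdge S′ a b → Slack S′ 1) →
                 ∀ {v} → S v ≡ true → (v∈ts? : Dec (v ∈ ts)) (v∈ps? : Dec (v ∈ a ∷ b ∷ [])) →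
                 ∃[ s′ ] Slack (S ∖ v) s′ × 𝟙 (does v∈ts?) + 1 ≤ s′ + 𝟙 (does v∈ps?)
      deletion _ {v} Sv (yes v∈ts) (yes _) =
        1 , rainbow-free-slack (S ∖ v) (rainbow-free-∖ S trapped ts≤3 v∈ts) (nonedge-nonempty-∖ S nonedge Sv) ,
        ℕ.≤-refl
      deletion _ {v} Sv (yes v∈ts) (no v∉ab) =
        2 , rainbow-free-nonedge-slack (S ∖ v) (rainbow-free-∖ S trapped ts≤3 v∈ts) (nonedge-∖ S nonedge v∉ab) ,
        ℕ.≤-refl
      deletion _ {v} Sv (no _) (yes _) =
        0 , trapped-slack (S ∖ v) (trapped-∖ S trapped) ts≤3 , ℕ.≤-refl
      deletion ih {v} Sv (no _) (no v∉ab) =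
        1 , ih (S ∖ v) (size-∖ S Sv ∣S∣≡1+m) (trapped-∖ S trapped) (nonedge-∖ S nonedge v∉ab) , ℕ.≤-refl

-- The whole graph

module WholeGraph {n : ℕ} (G : Graph n) (χ : Coloring G) where

  open InducedSubgraphs G χ
  open import Data.List.Membership.DecPropositional ℕ._≟_ using (_∈?_)

  full : VSet {n}
  full _ = true

  upper? : ∀ i j → Dec (toℕ i < toℕ j × adj G i j ≡ true)
  upper? i j = i <? j ×-dec (adj G i j Bool.≟ true)

  edge? : (p : Fin n × Fin n) → Dec (toℕ (proj₁ p) < toℕ (proj₂ p) × adj G (proj₁ p) (proj₂ p) ≡ true)
  edge? (i , j) = upper? i j

  e≡upper : e G ≡ ∑[ i < n ] count (λ j → does (upper? i j))
  e≡upper = begin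
    e G
      ≡⟨ length-filter-concatMap edge? (λ i → map (i ,_) (allFin n)) id ⟩
    ∑[ i < n ] length (filter edge? (map (i ,_) (allFin n)))
      ≡⟨ sum-cong-≗ (λ i → cong (length ∘ filter edge?) (map-tabulate id (i ,_))) ⟩
    ∑[ i < n ] length (filter edge? (tabulate (i ,_)))
      ≡⟨ sum-cong-≗ (λ i → length-filter-tabulate edge? (i ,_)) ⟩
    ∑[ i < n ] count (λ j → does (upper? i j))
      ∎
    where open ≡-Reasoning

  adj-split : ∀ i j → 𝟙 (adj G i j) ≡ 𝟙 (does (upper? i j)) + 𝟙 (does (upper? j i))
  adj-split i j = trans (split (i <? j) (j <? i))
    (cong₂ (λ x y → 𝟙 (does (i <? j) ∧ x) + 𝟙 (does (j <? i) ∧ y))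
           (sym (≟-true (adj G i j))) (sym (≟-true (adj G j i))))
    where
    ≟-true : ∀ b → does (b Bool.≟ true) ≡ b
    ≟-true true = refl
    ≟-true false = refl
    split : (i<j? : Dec (toℕ i < toℕ j)) (j<i? : Dec (toℕ j < toℕ i)) →
            𝟙 (adj G i j) ≡ 𝟙 (does i<j? ∧ adj G i j) + 𝟙 (does j<i? ∧ adj G j i)
    split (yes i<j) (yes j<i) = contradiction j<i (<-asym i<j)
    split (yes _) (no _) = sym (ℕ.+-identityʳ _)
    split (no _) (yes _) = cong 𝟙 (Graph.sym G i j)
    split (no i≮j) (no j≮i) with <-cmp i j
    ... | tri< i<j _ _ = contradiction i<j i≮j
    ... | tri> _ _ j<i = contradiction j<i j≮i
    ... | tri≈ _ refl _ = cong 𝟙 (Graph.irrefl G i)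

  degSum-full : degSum full ≡ 2 * e G
  degSum-full = begin
    degSum full
      ≡⟨ sum-cong-≗ (λ i → ℕ.*-identityˡ (deg full i)) ⟩
    ∑[ i < n ] ∑[ j < n ] 𝟙 (adj G i j)
      ≡⟨ sum-cong-≗ (λ i → trans (sum-cong-≗ (adj-split i)) (∑-distrib-+ (λ j → upper i j) (λ j → upper j i))) ⟩
    ∑[ i < n ] (∑[ j < n ] upper i j + ∑[ j < n ] upper j i)
      ≡⟨ ∑-distrib-+ (λ i → ∑[ j < n ] upper i j) (λ i → ∑[ j < n ] upper j i) ⟩
    ∑[ i < n ] ∑[ j < n ] upper i j + ∑[ i < n ] ∑[ j < n ] upper j i
      ≡⟨ cong (∑[ i < n ] ∑[ j < n ] upper i j +_) (∑-comm (λ i j → upper j i)) ⟩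
    ∑[ i < n ] ∑[ j < n ] upper i j + ∑[ i < n ] ∑[ j < n ] upper i j
      ≡⟨ cong₂ _+_ e≡upper e≡upper ⟨
    e G + e G
      ≡⟨ cong (e G +_) (ℕ.+-identityʳ (e G)) ⟨
    2 * e G
      ∎
    where
    open ≡-Reasoning
    upper : Fin n → Fin n → ℕ
    upper i j = 𝟙 (does (upper? i j))

  pairs : List (Fin n × Fin n)
  pairs = concatMap (λ i → map (i ,_) (allFin n)) (allFin n)

  ∈-pairs : ∀ i j → (i , j) ∈ pairs
  ∈-pairs i j = ∈-concat⁺′ (∈-map⁺ (i ,_) (∈-allFin j)) (∈-map⁺ (λ i → map (i ,_) (allFin n)) (∈-allFin i))

  colour : Fin n × Fin n → ℕ
  colour (i , j) = col χ i j

  edge-colours : List ℕ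
  edge-colours = map colour (edges G)

  occurs⇒∈ : ∀ {κ} → Occurs full κ → κ ∈ edge-colours
  occurs⇒∈ (i , j , _ , _ , ij , refl) with <-cmp i j
  ... | tri< i<j _ _ = ∈-map∘filter⁺ colour edge? ((i , j) , ∈-pairs i j , refl , i<j , ij)
  ... | tri> _ _ j<i =
    ∈-map∘filter⁺ colour edge? ((j , i) , ∈-pairs j i , Coloring.colSym χ i j , j<i , trans (Graph.sym G j i) ij)
  ... | tri≈ _ refl _ = contradiction refl (adj⇒≢ ij)

  ∈⇒occurs : ∀ {κ} → κ ∈ edge-colours → Occurs full κ
  ∈⇒occurs κ∈ =
    let (i , j) , _ , κ≡ij , _ , ij = ∈-map∘filter⁻ colour edge? {xs = pairs} κ∈
    in i , j , refl , refl , ij , sym κ≡ij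

  col<palette : ∀ i j → col χ i j < palette
  col<palette i j = s≤s (ℕ.≤-trans (≤-sum (col χ i) j) (≤-sum {n = n} (λ i → ∑[ j < n ] col χ i j) i))

  colours-full : colours full ≡ c χ
  colours-full = begin
    colours full
      ≡⟨ sum-cong-≗ {n = palette} (λ κ → 𝟙-does-⇔ (occurs? full (toℕ κ)) (toℕ κ ∈? distinct)
           (∈-deduplicate⁺ ℕ._≟_ ∘ occurs⇒∈) (∈⇒occurs ∘ ∈-deduplicate⁻ ℕ._≟_ edge-colours)) ⟩
    count {palette} (λ κ → does (toℕ κ ∈? distinct))
      ≡⟨ length-unique distinct (deduplicate-! edge-colours)
                      (All.tabulate (bounded ∘ ∈-deduplicate⁻ ℕ._≟_ edge-colours)) ⟨
    c χ
      ∎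
    where
    open ≡-Reasoning
    distinct : List ℕ
    distinct = deduplicate ℕ._≟_ edge-colours
    bounded : ∀ {κ} → κ ∈ edge-colours → κ < palette
    bounded κ∈ with ∈⇒occurs κ∈
    ... | i , j , _ , _ , _ , refl = col<palette i j

  weight-full : weight full ≡ 2 * (e G + c χ)
  weight-full = trans (cong₂ (λ d k → d + 2 * k) degSum-full colours-full) (sym (ℕ.*-distribˡ-+ 2 (e G) (c χ)))

  slack⇒bound : ∀ {s} → Slack full s → e G + c χ + s ≤ (n + 1) C 2
  slack⇒bound {s} slack = ℕ.*-cancelˡ-≤ 2 (begin
    2 * (e G + c χ + s)          ≡⟨ ℕ.*-distribˡ-+ 2 (e G + c χ) s ⟩
    2 * (e G + c χ) + 2 * s      ≡⟨ cong (_+ 2 * s) weight-full ⟨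
    weight full + 2 * s          ≤⟨ slack ⟩
    ∣ full ∣ * suc ∣ full ∣       ≡⟨ cong (λ m → m * suc m) (count-all n) ⟩
    n * suc n                     ≡⟨ double-choose-2 n ⟨
    2 * (suc n C 2)               ≡⟨ cong (λ m → 2 * (m C 2)) (ℕ.+-comm 1 n) ⟩
    2 * ((n + 1) C 2)             ∎)
    where open ℕ.≤-Reasoning

  module _ {i j k} (unique : ∀ a b c → RainbowTriangle χ a b c → (a , b , c) ≡ (i , j , k)) where

    sorted-trapped : ∀ {a b c} → toℕ a < toℕ b → toℕ b < toℕ c → Rainbow△ a b c →
                     a ∈ i ∷ j ∷ k ∷ [] × b ∈ i ∷ j ∷ k ∷ [] × c ∈ i ∷ j ∷ k ∷ []
    sorted-trapped a<b b<c (ab , bc , ac , rainbow) with unique _ _ _ ((a<b , b<c , ab , bc , ac) , rainbow)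
    ... | refl = here refl , there (here refl) , there (there (here refl))

    least-first-trapped : ∀ {a b c} → toℕ a < toℕ b → Rainbow△ a b c →
                          a ∈ i ∷ j ∷ k ∷ [] × b ∈ i ∷ j ∷ k ∷ [] × c ∈ i ∷ j ∷ k ∷ []
    least-first-trapped {a} {b} {c} a<b r@(_ , bc , ac , _) with <-cmp b c
    ... | tri< b<c _ _ = sorted-trapped a<b b<c r
    ... | tri≈ _ refl _ = contradiction refl (adj⇒≢ bc)
    ... | tri> _ _ c<b with <-cmp a c
    ...   | tri< a<c _ _ = let a∈ , c∈ , b∈ = sorted-trapped a<c c<b (△-swap₂₃ r) in a∈ , b∈ , c∈
    ...   | tri≈ _ refl _ = contradiction refl (adj⇒≢ ac)
    ...   | tri> _ _ c<a = let c∈ , a∈ , b∈ = sorted-trapped c<a a<b (△-swap₁₂ (△-swap₂₃ r)) in a∈ , b∈ , c∈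

    rainbow-trapped : RainbowTrappedIn full (i ∷ j ∷ k ∷ [])
    rainbow-trapped {a} {b} _ _ _ r@(ab , _) with <-cmp a b
    ... | tri< a<b _ _ = least-first-trapped a<b r
    ... | tri≈ _ refl _ = contradiction refl (adj⇒≢ ab)
    ... | tri> _ _ b<a = let b∈ , a∈ , c∈ = least-first-trapped b<a (△-swap₁₂ r) in a∈ , b∈ , c∈

lemma6 : (n : ℕ) → n ≥ 3 → (G : Graph n) → (χ : Coloring G) →
         e G + c χ ≥ (n + 1) C 2 →
         ExactlyOneRainbowTriangle χ →
         (e G + c χ ≡ (n + 1) C 2) × Complete G
lemma6 n _ G χ e+c≥ ((i , j , k) , _ , unique) = ℕ.≤-antisym e+c≤ e+c≥ , complete
  where
  open InducedSubgraphs G χ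
  open WholeGraph G χ
  trapped : RainbowTrappedIn full (i ∷ j ∷ k ∷ [])
  trapped = rainbow-trapped unique
  e+c≤ : e G + c χ ≤ (n + 1) C 2
  e+c≤ = ℕ.≤-trans (ℕ.m≤m+n (e G + c χ) 0) (slack⇒bound (trapped-slack full trapped ℕ.≤-refl))
  complete : Complete G
  complete a b a≢b with adj G a b in ab
  ... | true = refl
  ... | false = ⊥-elim (ℕ.≤⇒≯ e+c≥ (ℕ.≤-trans (ℕ.≤-reflexive (ℕ.+-comm 1 (e G + c χ)))
                  (slack⇒bound (trapped-nonedge-slack full trapped ℕ.≤-refl (refl , refl , a≢b , ab)))))
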